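{- Let $G$ be a connected graph with $n$ vertices and positive edge lengths $\ell$, let $H$ be a subgraph of $G$, and let $0<\delta\le\varepsilon(G,\ell)$. Then every shortest path in $G$ with respect to the edge lengths $\hat\ell$ is a shortest path in $G$ with respect to $\ell$.
   Context: Lengths of paths are sums of their edge lengths. Define $\varepsilon(G,\ell)=\frac{1}{n}\min\{\ell(\pi)-\ell(\pi')\mid \pi,\pi' \text{ paths in } G \text{ with } \ell(\pi)>\ell(\pi')\}$ (the empty path is allowed). Given $H\subseteq G$ and $\delta$, define $\hat\ell(e)=\ell(e)$ if $e\in E(H)$ and $\hat\ell(e)=\ell(e)-\delta$ if $e\in E(G)\setminus E(H)$.
   Formalization: The edge lengths ℓ and the parameter δ take rational values. -}

module Defs where

open import Data.Nat using (ℕ)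
open import Data.Bool using (Bool; true; false; if_then_else_)
open import Data.Fin using (Fin)
open import Data.List using (List; []; _∷_; last)
open import Data.List.Relation.Unary.Unique.Propositional using (Unique)
open import Data.Maybe using (just)
open import Data.Product using (_×_; Σ; ∃)
open import Data.Integer using (+_)
open import Data.Rational using (ℚ; 0ℚ; _+_; _-_; _*_; _≤_; _<_; _/_)
open import Relation.Binary.PropositionalEquality using (_≡_)

record Graph (n : ℕ) : Set where
  field
    adj     : Fin n → Fin n → Bool
    symm    : ∀ u v → adj u v ≡ adj v u
    irrefl  : ∀ u → adj u u ≡ false
open Graph public

-- H is a subgraph of G (only edges matter for the edge lengths ℓ̂).
_⊆G_ : ∀ {n} → Graph n → Graph n → Set
H ⊆G G = ∀ u v → adj H u v ≡ true → adj G u v ≡ true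

-- Edge lengths: a symmetric function on pairs of vertices (values on
-- non-adjacent pairs are irrelevant).
Lengths : ℕ → Set
Lengths n = Fin n → Fin n → ℚ

SymmetricLengths : ∀ {n} → Lengths n → Set
SymmetricLengths ℓ = ∀ u v → ℓ u v ≡ ℓ v u

PositiveOn : ∀ {n} → Graph n → Lengths n → Set
PositiveOn G ℓ = ∀ u v → adj G u v ≡ true → 0ℚ < ℓ u v

data Consecutive {n : ℕ} (G : Graph n) : List (Fin n) → Set where
  c-[]  : Consecutive G []
  c-[x] : ∀ x → Consecutive G (x ∷ [])
  c-∷   : ∀ x y ps → adj G x y ≡ true → Consecutive G (y ∷ ps) →
          Consecutive G (x ∷ y ∷ ps)

IsPath : ∀ {n} → Graph n → List (Fin n) → Set
IsPath G ps = Consecutive G ps × Unique ps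

len : ∀ {n} → Lengths n → List (Fin n) → ℚ
len ℓ []           = 0ℚ
len ℓ (x ∷ [])     = 0ℚ
len ℓ (x ∷ y ∷ ps) = ℓ x y + len ℓ (y ∷ ps)

PathFromTo : ∀ {n} → Graph n → Fin n → Fin n → List (Fin n) → Set
PathFromTo G u v ps = IsPath G ps × Σ (List _) (λ rest → ps ≡ u ∷ rest) × last ps ≡ just v

Connected : ∀ {n} → Graph n → Set
Connected G = ∀ u v → ∃ λ ps → PathFromTo G u v ps

IsShortestPath : ∀ {n} → Graph n → Lengths n → Fin n → Fin n → List (Fin n) → Set
IsShortestPath G w u v ps =
  PathFromTo G u v ps × (∀ qs → PathFromTo G u v qs → len w ps ≤ len w qs)

-- "δ ≤ ε(G,ℓ)" where ε(G,ℓ) = (1/n) min{ℓ(π) - ℓ(π') | π, π' paths in G,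
-- ℓ(π) > ℓ(π')}: δ is below every element of that set divided by n,
-- i.e. n·δ ≤ ℓ(π) - ℓ(π') for all such pairs of paths.
AtMostEpsilon : ∀ {n} → Graph n → Lengths n → ℚ → Set
AtMostEpsilon {n} G ℓ δ =
  ∀ π π' → IsPath G π → IsPath G π' → len ℓ π' < len ℓ π →
  ((+ n) / 1) * δ ≤ len ℓ π - len ℓ π'

lhat : ∀ {n} → Graph n → Lengths n → ℚ → Lengths n
lhat H ℓ δ u v = if adj H u v then ℓ u v else ℓ u v - δ

{-# OPTIONS --safe #-}
module Submission where

-- Lowering the off-H edges by δ moves every edge length by 0 or δ, so a
-- path with k edges satisfies ℓ̂(π) ≤ ℓ(π) ≤ ℓ̂(π) + kδ, and k < n because
-- its vertices are distinct.  If π is ℓ̂-shortest and π′ has the same ends,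
-- then ℓ(π) ≤ ℓ̂(π′) + kδ ≤ ℓ(π′) + kδ < ℓ(π′) + nδ; but by the choice of δ
-- two path lengths that differ at all differ by at least nδ, so ℓ(π) ≤ ℓ(π′).

open import Defs
open import Data.Nat using (ℕ)
open import Data.Fin using (Fin)
open import Data.List using (List)
open import Data.Rational using (ℚ; 0ℚ; _<_)

open import Algebra.Bundles using (CommutativeMonoid)
open import Data.Bool using (true; false)
open import Data.Empty using (⊥-elim)
open import Data.Fin using (zero; suc)
open import Data.Fin.Properties using (injective⇒≤)
open import Data.Integer using (+_)
import Data.Integer as ℤ
import Data.Integer.Properties as ℤ
open import Data.List using ([]; _∷_; length; lookup)
open import Data.List.Membership.Propositional.Properties using (∈-lookup)
import Data.List.Relation.Unary.All as All
open import Data.List.Relation.Unary.AllPairs using (_∷_)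
open import Data.List.Relation.Unary.Unique.Propositional using (Unique)
open import Data.Nat using (suc; pred; _<′_; ≤′-refl; ≤′-step)
  renaming (_≤_ to _≤ℕ_; _<_ to _<ℕ_)
open import Data.Nat.Coprimality using (Coprime; 1-coprimeTo) renaming (sym to coprime-sym)
open import Data.Nat.Properties using (<⇒<′)
open import Data.Product using (_,_; proj₁)
open import Data.Rational using (1ℚ; mkℚ; _+_; _-_; _*_; _/_; _≤_; _≤?_)
open import Data.Rational.Properties
open import Algebra.Properties.Group +-0-group using (//-rightDividesˡ)
open import Algebra.Properties.CommutativeSemigroup
  (CommutativeMonoid.commutativeSemigroup +-0-commutativeMonoid) using (interchange)
open import Function.Definitions using (Injective)
open import Relation.Nullary using (yes; no)
open import Relation.Binary.PropositionalEquality
  using (_≡_; refl; sym; trans; cong; module ≡-Reasoning)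

lookup-injective : ∀ {A : Set} {xs : List A} → Unique xs → Injective _≡_ _≡_ (lookup xs)
lookup-injective {xs = _ ∷ _} _            {zero}  {zero}  _  = refl
lookup-injective {xs = _ ∷ _} (x∉xs ∷ _)   {zero}  {suc j} eq = ⊥-elim (All.lookup x∉xs (∈-lookup j) eq)
lookup-injective {xs = _ ∷ _} (x∉xs ∷ _)   {suc i} {zero}  eq = ⊥-elim (All.lookup x∉xs (∈-lookup i) (sym eq))
lookup-injective {xs = _ ∷ _} (_ ∷ unique) {suc i} {suc j} eq = cong suc (lookup-injective unique eq)

unique⇒length≤ : ∀ {n} {xs : List (Fin n)} → Unique xs → length xs ≤ℕ n
unique⇒length≤ unique = injective⇒≤ (lookup-injective unique)

infixl 7 _·_

_·_ : ℕ → ℚ → ℚ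
k · q = (+ k / 1) * q

-- For a variable k, gcd k 1 is stuck, so + k / 1 must be brought to normal form by hand.
[1+k]/1≡1+k/1 : ∀ k → + suc k / 1 ≡ 1ℚ + + k / 1
[1+k]/1≡1+k/1 k = begin
  + suc k / 1                ≡⟨ cong (λ z → (+ 1 ℤ.+ z) / 1) (sym (ℤ.*-identityʳ (+ k))) ⟩
  1ℚ + mkℚ (+ k) 0 k⊥1       ≡⟨ cong (λ z → 1ℚ + z) (normalize-coprime k⊥1) ⟨
  1ℚ + + k / 1               ∎
  where
  open ≡-Reasoning
  k⊥1 : Coprime k 1
  k⊥1 = coprime-sym (1-coprimeTo k)

suc-· : ∀ k q → suc k · q ≡ q + k · q
suc-· k q = begin
  (+ suc k / 1) * q          ≡⟨ cong (_* q) ([1+k]/1≡1+k/1 k) ⟩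
  (1ℚ + + k / 1) * q         ≡⟨ *-distribʳ-+ q 1ℚ (+ k / 1) ⟩
  1ℚ * q + k · q             ≡⟨ cong (_+ k · q) (*-identityˡ q) ⟩
  q + k · q                  ∎
  where open ≡-Reasoning

·-monoˡ-< : ∀ {q} → 0ℚ < q → ∀ {j k} → j <ℕ k → j · q < k · q
·-monoˡ-< {q} q>0 j<k = go (<⇒<′ j<k)
  where
  step : ∀ k → k · q < suc k · q
  step k = begin-strict
    k · q          ≡⟨ +-identityˡ (k · q) ⟨
    0ℚ + k · q     <⟨ +-monoˡ-< (k · q) q>0 ⟩
    q + k · q      ≡⟨ suc-· k q ⟨
    suc k · q      ∎
    where open ≤-Reasoning
  go : ∀ {j k} → j <′ k → j · q < k · q
  go {j}         ≤′-refl       = step j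
  go {k = suc k} (≤′-step j<k) = <-trans (go j<k) (step k)

≤-by-gap : ∀ {p q g h} → p ≤ q + g → g < h → (q < p → h ≤ p - q) → p ≤ q
≤-by-gap {p} {q} {g} {h} p≤q+g g<h gap with p ≤? q
... | yes p≤q = p≤q
... | no  p≰q = ⊥-elim (<-irrefl refl (begin-strict
  p            ≤⟨ p≤q+g ⟩
  q + g        <⟨ +-monoʳ-< q g<h ⟩
  q + h        ≤⟨ +-monoʳ-≤ q (gap (≰⇒> p≰q)) ⟩
  q + (p - q)  ≡⟨ +-comm q (p - q) ⟩
  p - q + q    ≡⟨ //-rightDividesˡ q p ⟩
  p            ∎))
  where open ≤-Reasoning

#edges : ∀ {A : Set} → List A → ℕ
#edges ps = pred (length ps)

path-#edges<n : ∀ {n} {G : Graph n} {u v π} → PathFromTo G u v π → #edges π <ℕ n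
path-#edges<n ((_ , unique) , (_ , refl) , _) = unique⇒length≤ unique

module _ {n : ℕ} {w w′ : Lengths n} where

  len-mono-≤ : (∀ x y → w x y ≤ w′ x y) → ∀ ps → len w ps ≤ len w′ ps
  len-mono-≤ w≤w′ []           = ≤-refl
  len-mono-≤ w≤w′ (x ∷ [])     = ≤-refl
  len-mono-≤ w≤w′ (x ∷ y ∷ ps) = +-mono-≤ (w≤w′ x y) (len-mono-≤ w≤w′ (y ∷ ps))

  len≤len+#edges· : ∀ {d} → (∀ x y → w′ x y ≤ w x y + d) →
                    ∀ ps → len w′ ps ≤ len w ps + #edges ps · d
  len≤len+#edges· {d} _ []       = ≤-reflexive (sym (trans (+-identityˡ (0 · d)) (*-zeroˡ d)))
  len≤len+#edges· {d} _ (x ∷ []) = ≤-reflexive (sym (trans (+-identityˡ (0 · d)) (*-zeroˡ d)))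
  len≤len+#edges· {d} w′≤w+d (x ∷ y ∷ ps) = begin
    w′ x y + len w′ (y ∷ ps)                ≤⟨ +-mono-≤ (w′≤w+d x y) (len≤len+#edges· w′≤w+d (y ∷ ps)) ⟩
    (w x y + d) + (len w (y ∷ ps) + k · d)  ≡⟨ interchange (w x y) d (len w (y ∷ ps)) (k · d) ⟩
    (w x y + len w (y ∷ ps)) + (d + k · d)  ≡⟨ cong (λ z → w x y + len w (y ∷ ps) + z) (suc-· k d) ⟨
    (w x y + len w (y ∷ ps)) + suc k · d    ∎
    where
    open ≤-Reasoning
    k : ℕ
    k = #edges (y ∷ ps)

module _ {n : ℕ} (H : Graph n) (ℓ : Lengths n) {δ : ℚ} (δ≥0 : 0ℚ ≤ δ) where

  lhat≤ℓ : ∀ x y → lhat H ℓ δ x y ≤ ℓ x y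
  lhat≤ℓ x y with adj H x y
  ... | true  = ≤-refl
  ... | false = begin
    ℓ x y - δ   ≤⟨ +-monoʳ-≤ (ℓ x y) (neg-antimono-≤ δ≥0) ⟩
    ℓ x y + 0ℚ  ≡⟨ +-identityʳ (ℓ x y) ⟩
    ℓ x y       ∎
    where open ≤-Reasoning

  ℓ≤lhat+δ : ∀ x y → ℓ x y ≤ lhat H ℓ δ x y + δ
  ℓ≤lhat+δ x y with adj H x y
  ... | true  = begin
    ℓ x y       ≡⟨ +-identityʳ (ℓ x y) ⟨
    ℓ x y + 0ℚ  ≤⟨ +-monoʳ-≤ (ℓ x y) δ≥0 ⟩
    ℓ x y + δ   ∎
    where open ≤-Reasoning
  ... | false = ≤-reflexive (sym (//-rightDividesˡ δ (ℓ x y)))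

lemma5 : (n : ℕ) (G H : Graph n) (ℓ : Lengths n) (δ : ℚ) →
    Connected G → SymmetricLengths ℓ → PositiveOn G ℓ → H ⊆G G →
    0ℚ < δ → AtMostEpsilon G ℓ δ →
    ∀ (u v : Fin n) (π : List (Fin n)) →
    IsShortestPath G (lhat H ℓ δ) u v π → IsShortestPath G ℓ u v π
lemma5 n G H ℓ δ _ _ _ _ δ>0 δ≤ε u v π (π-path , π-shortest) = π-path , ℓ-shortest
  where
  open ≤-Reasoning
  ℓ̂ : Lengths n
  ℓ̂ = lhat H ℓ δ
  k : ℕ
  k = #edges π
  ℓ-shortest : ∀ π′ → PathFromTo G u v π′ → len ℓ π ≤ len ℓ π′
  ℓ-shortest π′ π′-path = ≤-by-gap ℓπ≤ℓπ′+kδ (·-monoˡ-< δ>0 (path-#edges<n π-path))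
                                   (δ≤ε π π′ (proj₁ π-path) (proj₁ π′-path))
    where
    ℓπ≤ℓπ′+kδ : len ℓ π ≤ len ℓ π′ + k · δ
    ℓπ≤ℓπ′+kδ = begin
      len ℓ π            ≤⟨ len≤len+#edges· (ℓ≤lhat+δ H ℓ (<⇒≤ δ>0)) π ⟩
      len ℓ̂ π + k · δ    ≤⟨ +-monoˡ-≤ (k · δ) (π-shortest π′ π′-path) ⟩
      len ℓ̂ π′ + k · δ   ≤⟨ +-monoˡ-≤ (k · δ) (len-mono-≤ (lhat≤ℓ H ℓ (<⇒≤ δ>0)) π′) ⟩
      len ℓ π′ + k · δ   ∎
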